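{- For every integer $t\geq1$, with $N_{t,1}=3t^2+2t$, $N_{t,2}=3t^2+4t+1$ and $N_{t,3}=3t^2+6t+2$, the following digraphs are tight $2$--Cayley digraphs over non-cyclic groups: (i) $\mathrm{Cay}(\mathbb{Z}_m\oplus\mathbb{Z}_{mN_{t,1}},\{(1,t),(2,2t+1)\})$ for $2\leq m\leq 6t+1$; (ii) $\mathrm{Cay}(\mathbb{Z}_m\oplus\mathbb{Z}_{mN_{t,2}},\{(1,t),(2,2t+1)\})$ for $2\leq m\leq 6t+3$; (iii) $\mathrm{Cay}(\mathbb{Z}_m\oplus\mathbb{Z}_{mN_{t,3}},\{(2,2t+1),(1,t)\})$ for $2\leq m\leq 2t+1$.
   Context: For a finite Abelian group $\mathrm{G}$ and $a,b\in\mathrm{G}\setminus\{0\}$ generating $\mathrm{G}$, $\mathrm{Cay}(\mathrm{G},\{a,b\})$ is the digraph with vertex set $\mathrm{G}$ and arcs $g\to g+a$, $g\to g+b$. Such a digraph of order $N$ is tight if its diameter equals $\lceil\sqrt{3N}\rceil-2$. -}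

module Defs where

open import Data.Nat using (ℕ; zero; suc; _+_; _*_; _∸_; _≤_; _<_; NonZero)
open import Data.Nat.DivMod using (_mod_)
open import Data.Fin using (Fin; toℕ)
open import Data.Product using (_×_; _,_; ∃; ∃-syntax; Σ-syntax)
open import Data.Empty using (⊥)
open import Relation.Nullary using (¬_)
open import Relation.Binary.PropositionalEquality using (_≡_)

module ZZ (m M : ℕ) .{{_ : NonZero m}} .{{_ : NonZero M}} where

  G : Set
  G = Fin m × Fin M

  elt : ℕ → ℕ → G
  elt i j = (i mod m , j mod M)

  0G : G
  0G = elt 0 0

  _⊕_ : G → G → G
  (x , y) ⊕ (a , b) = ((toℕ x + toℕ a) mod m , (toℕ y + toℕ b) mod M)

  _·_ : ℕ → G → G
  zero  · g = 0G
  suc k · g = g ⊕ (k · g)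

  data Walk (a b : G) : G → G → ℕ → Set where
    here  : ∀ {u} → Walk a b u u 0
    stepA : ∀ {u v k} → Walk a b (u ⊕ a) v k → Walk a b u v (suc k)
    stepB : ∀ {u v k} → Walk a b (u ⊕ b) v k → Walk a b u v (suc k)

  IsDiameter : G → G → ℕ → Set
  IsDiameter a b D =
    (∀ u v → ∃[ k ] (k ≤ D × Walk a b u v k)) ×
    (∃[ u ] ∃[ v ] (∀ k → k < D → ¬ Walk a b u v k))

  Generates : G → G → Set
  Generates a b = ∀ x → ∃[ i ] ∃[ j ] ((i · a) ⊕ (j · b) ≡ x)

  NonCyclic : Set
  NonCyclic = ¬ (∃[ g ] (∀ x → ∃[ k ] (k · g ≡ x)))

IsCeilSqrt : ℕ → ℕ → Set
IsCeilSqrt n c = n ≤ c * c × (∀ d → n ≤ d * d → c ≤ d)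

-- Cay(Z_m ⊕ Z_M, {(a1,a2),(b1,b2)}) is a tight 2-Cayley digraph over a non-cyclic
-- group: a, b nonzero and generating, the group is non-cyclic, and the diameter
-- equals ⌈√(3N)⌉ - 2 where N = m·M is the order.
-- (For m = 0 or M = 0 the group is not finite; the predicate is then ⊥.)
TightCay : (m M : ℕ) → (a1 a2 b1 b2 : ℕ) → Set
TightCay zero M a1 a2 b1 b2 = ⊥
TightCay (suc m) zero a1 a2 b1 b2 = ⊥
TightCay (suc m) (suc M) a1 a2 b1 b2 =
  ¬ (a ≡ 0G) × ¬ (b ≡ 0G) × Generates a b × NonCyclic ×
  (∀ c → IsCeilSqrt (3 * N) c → IsDiameter a b (c ∸ 2))
  where
  open ZZ (suc m) (suc M)
  a = elt a1 a2
  b = elt b1 b2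
  N = suc m * suc M

N₁ N₂ N₃ : ℕ → ℕ
N₁ t = 3 * t * t + 2 * t
N₂ t = 3 * t * t + 4 * t + 1
N₃ t = 3 * t * t + 6 * t + 2

-- Write elements of Z_m ⊕ Z_{mN} as i·a + j·b with a = (1,t), b = (2,2t+1); a walk of length k from u
-- to v is exactly such a pair with i + j = k. On the quotient Z_N, N = 3t² + 2t + c(2t+1), the steps t
-- and 2t+1 reach every residue within D = 3t + c − 1 steps, while the residue of T = t·2t + (2t+1)(t−1+c)
-- needs D of them: modulo N the only short candidates are T and T − N, and neither is attained.
-- Since [[1,2],[t,2t+1]] has determinant 1, the Z_m coordinate is fixed by a pair of digits below m, so
-- every element is reached within m·D + 2(m−1) steps, and the lift of T with both digits m − 1 needs
-- exactly that many. As 3N + δ = (3t+c+1)² with m·δ < 2(3t+c+1), this number is ⌈√(3m²N)⌉ − 2.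
-- The group is not cyclic because 2 ≤ m divides mN.

module Submission where

open import Defs
open import Data.Nat
open import Data.Nat.Properties
open import Data.Nat.DivMod
open import Data.Nat.Divisibility using (_∣_; divides; ∣m+n∣m⇒∣n; m∣m*n)
open import Data.Nat.Tactic.RingSolver using (solve-∀)
open import Data.Fin using (toℕ)
open import Data.Fin.Properties using (toℕ-fromℕ<; toℕ-injective; toℕ<n)
open import Data.Product using (_×_; _,_; proj₁; proj₂; ∃; ∃₂; ∃-syntax)
open import Function using (_∘_; case_of_)
open import Level using (0ℓ)
open import Relation.Nullary using (¬_; yes; no; contradiction)
open import Relation.Binary.Bundles using (Setoid)
open import Relation.Binary.PropositionalEquality
import Relation.Binary.Reasoning.Setoid as SetoidReasoning

-- Congruence modulo n on ℕ, witnessed by explicit multiples (so n = 0 needs no special case).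
infix 4 _≡_[mod_]

record _≡_[mod_] (a b n : ℕ) : Set where
  constructor multiples
  field
    k l      : ℕ
    equation : a + k * n ≡ b + l * n

module _ {n : ℕ} where

  mod-refl : ∀ {a} → a ≡ a [mod n ]
  mod-refl = multiples 0 0 refl

  mod-reflexive : ∀ {a b} → a ≡ b → a ≡ b [mod n ]
  mod-reflexive refl = mod-refl

  mod-sym : ∀ {a b} → a ≡ b [mod n ] → b ≡ a [mod n ]
  mod-sym (multiples k l e) = multiples l k (sym e)

  mod-trans : ∀ {a b c} → a ≡ b [mod n ] → b ≡ c [mod n ] → a ≡ c [mod n ]
  mod-trans {a} {b} {c} (multiples k l e) (multiples k′ l′ e′) = multiples (k + k′) (l′ + l) (begin
    a + (k + k′) * n       ≡⟨ shuffle a k k′ n ⟩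
    (a + k * n) + k′ * n   ≡⟨ cong (_+ k′ * n) e ⟩
    (b + l * n) + k′ * n   ≡⟨ exchange b l k′ n ⟩
    (b + k′ * n) + l * n   ≡⟨ cong (_+ l * n) e′ ⟩
    (c + l′ * n) + l * n   ≡⟨ sym (shuffle c l′ l n) ⟩
    c + (l′ + l) * n       ∎)
    where
    open ≡-Reasoning
    shuffle : ∀ a k k′ n → a + (k + k′) * n ≡ (a + k * n) + k′ * n
    shuffle = solve-∀
    exchange : ∀ b l k′ n → (b + l * n) + k′ * n ≡ (b + k′ * n) + l * n
    exchange = solve-∀

  mod-+-multiple : ∀ a q → a + q * n ≡ a [mod n ]
  mod-+-multiple a q = multiples 0 q (+-identityʳ _)

  mod-+ : ∀ {a b c d} → a ≡ b [mod n ] → c ≡ d [mod n ] → a + c ≡ b + d [mod n ]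
  mod-+ {a} {b} {c} {d} (multiples k l e) (multiples k′ l′ e′) =
    multiples (k + k′) (l + l′) (trans (regroup a c k k′ n) (trans (cong₂ _+_ e e′) (sym (regroup b d l l′ n))))
    where
    regroup : ∀ a c k k′ n → (a + c) + (k + k′) * n ≡ (a + k * n) + (c + k′ * n)
    regroup = solve-∀

  mod-* : ∀ {a b c d} → a ≡ b [mod n ] → c ≡ d [mod n ] → a * c ≡ b * d [mod n ]
  mod-* {a} {b} {c} {d} (multiples k l e) (multiples k′ l′ e′) =
    multiples (k * c + a * k′ + k * k′ * n) (l * d + b * l′ + l * l′ * n)
      (trans (sym (expand a c k k′ n)) (trans (cong₂ _*_ e e′) (expand b d l l′ n)))
    where
    expand : ∀ a c k k′ n → (a + k * n) * (c + k′ * n) ≡ a * c + (k * c + a * k′ + k * k′ * n) * n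
    expand = solve-∀

  mod-*ˡ : ∀ x {a b} → a ≡ b [mod n ] → x * a ≡ x * b [mod n ]
  mod-*ˡ x = mod-* (mod-refl {x})

  mod-+-cancelˡ : ∀ x {a b} → x + a ≡ x + b [mod n ] → a ≡ b [mod n ]
  mod-+-cancelˡ x {a} {b} (multiples k l e) =
    multiples k l (+-cancelˡ-≡ x _ _ (trans (sym (+-assoc x a (k * n))) (trans e (+-assoc x b (l * n)))))

  mod-+-cancelʳ : ∀ x {a b} → a + x ≡ b + x [mod n ] → a ≡ b [mod n ]
  mod-+-cancelʳ x {a} {b} p =
    mod-+-cancelˡ x (mod-trans (mod-reflexive (+-comm x a)) (mod-trans p (mod-reflexive (+-comm b x))))

mod-setoid : ℕ → Setoid 0ℓ 0ℓ
mod-setoid n = record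
  { Carrier       = ℕ
  ; _≈_           = _≡_[mod n ]
  ; isEquivalence = record { refl = mod-refl ; sym = mod-sym ; trans = mod-trans }
  }

module ModReasoning (n : ℕ) = SetoidReasoning (mod-setoid n)

mod-∣ : ∀ {d n a b} → d ∣ n → a ≡ b [mod n ] → a ≡ b [mod d ]
mod-∣ {d} {n} {a} {b} (divides q refl) (multiples k l e) =
  multiples (k * q) (l * q) (trans (cong (a +_) (*-assoc k q d)) (trans e (cong (b +_) (sym (*-assoc l q d)))))

mod-scale : ∀ m {n a b} → a ≡ b [mod n ] → m * a ≡ m * b [mod m * n ]
mod-scale m {n} {a} {b} (multiples k l e) =
  multiples k l (trans (distrib m a k n) (trans (cong (m *_) e) (sym (distrib m b l n))))
  where
  distrib : ∀ m a k n → m * a + k * (m * n) ≡ m * (a + k * n)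
  distrib = solve-∀

mod-unscale : ∀ m {n a b} .{{_ : NonZero m}} → m * a ≡ m * b [mod m * n ] → a ≡ b [mod n ]
mod-unscale m {n} {a} {b} (multiples k l e) =
  multiples k l (*-cancelˡ-≡ _ _ m (trans (sym (distrib m a k n)) (trans e (distrib m b l n))))
  where
  distrib : ∀ m a k n → m * a + k * (m * n) ≡ m * (a + k * n)
  distrib = solve-∀

module _ {n : ℕ} .{{_ : NonZero n}} where

  mod-% : ∀ a → a % n ≡ a [mod n ]
  mod-% a = multiples (a / n) 0 (trans (sym (m≡m%n+[m/n]*n a n)) (sym (+-identityʳ a)))

  mod⇒%≡ : ∀ {a b} → a ≡ b [mod n ] → a % n ≡ b % n
  mod⇒%≡ {a} {b} (multiples k l e) =
    trans (sym ([m+kn]%n≡m%n a k n)) (trans (cong (_% n) e) ([m+kn]%n≡m%n b l n))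

  mod⇒≡ : ∀ {a b} → a ≡ b [mod n ] → a < n → b < n → a ≡ b
  mod⇒≡ {a} {b} p a<n b<n = trans (sym (m<n⇒m%n≡m a<n)) (trans (mod⇒%≡ p) (m<n⇒m%n≡m b<n))

mod-+-∸ : ∀ {n} u v → u ≤ n → u + (v + (n ∸ u)) ≡ v [mod n ]
mod-+-∸ {n} u v u≤n = mod-trans (mod-reflexive eq) (mod-+-multiple v 1)
  where
  eq : u + (v + (n ∸ u)) ≡ v + 1 * n
  eq = begin
    u + (v + (n ∸ u))   ≡⟨ sym (+-assoc u v _) ⟩
    (u + v) + (n ∸ u)   ≡⟨ cong (_+ (n ∸ u)) (+-comm u v) ⟩
    (v + u) + (n ∸ u)   ≡⟨ +-assoc v u _ ⟩
    v + (u + (n ∸ u))   ≡⟨ cong (v +_) (trans (m+[n∸m]≡n u≤n) (sym (+-identityʳ n))) ⟩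
    v + 1 * n           ∎
    where open ≡-Reasoning

mod-+-modulus : ∀ {n} a → a + n ≡ a [mod n ]
mod-+-modulus {n} a = mod-trans (mod-reflexive (cong (a +_) (sym (*-identityˡ n)))) (mod-+-multiple a 1)

mod-below : ∀ {n a b} → a ≡ b [mod n ] → a < b + n → ∃[ q ] a + q * n ≡ b
mod-below {n} {a} {b} (multiples k l e) a<b+n with l ≤? k
... | yes l≤k with m≤n⇒∃[o]m+o≡n l≤k
...   | q , refl = q , +-cancelʳ-≡ (l * n) _ _ (trans (regroup a q l n) e)
  where
  regroup : ∀ a q l n → a + q * n + l * n ≡ a + (l + q) * n
  regroup = solve-∀
mod-below {n} {a} {b} (multiples k l e) a<b+n | no l≰k with m≤n⇒∃[o]m+o≡n (≰⇒> l≰k)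
...   | q , refl = contradiction a<b+n (≤⇒≯ (begin
  b + n            ≤⟨ +-monoʳ-≤ b (m≤m+n n (q * n)) ⟩
  b + suc q * n    ≡⟨ +-cancelʳ-≡ (k * n) _ _ (trans (regroup b k q n) (sym e)) ⟩
  a                ∎))
  where
  open ≤-Reasoning
  regroup : ∀ b k q n → b + suc q * n + k * n ≡ b + (suc k + q) * n
  regroup = solve-∀

mod-+-cancel : ∀ {n a b c d} → a + c ≡ b + d [mod n ] → c ≡ d [mod n ] → a ≡ b [mod n ]
mod-+-cancel {c = c} p c≡d = mod-+-cancelʳ c (mod-trans p (mod-+ mod-refl (mod-sym c≡d)))

mod-lift : ∀ {m N a b} .{{_ : NonZero N}} → a ≡ b [mod m ] → ∃[ z ] a + m * z ≡ b [mod m * N ]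
mod-lift {m} {suc N′} {a} {b} (multiples k l e) = k + l * N′ , multiples 0 l (begin
  a + m * (k + l * N′) + 0 * (m * suc N′)   ≡⟨ regroup a m k l N′ ⟩
  (a + k * m) + l * m * N′                   ≡⟨ cong (_+ l * m * N′) e ⟩
  (b + l * m) + l * m * N′                   ≡⟨ regroup′ b l m N′ ⟩
  b + l * (m * suc N′)                       ∎)
  where
  open ≡-Reasoning
  regroup : ∀ a m k l N′ → a + m * (k + l * N′) + 0 * (m * suc N′) ≡ (a + k * m) + l * m * N′
  regroup = solve-∀
  regroup′ : ∀ b l m N′ → (b + l * m) + l * m * N′ ≡ b + l * (m * suc N′)
  regroup′ = solve-∀

mod-residue : ∀ {n a r} .{{_ : NonZero n}} → a ≡ r [mod n ] → r < n → a ≡ r + (a / n) * n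
mod-residue {n} {a} p r<n = trans (m≡m%n+[m/n]*n a n) (cong (_+ (a / n) * n) (trans (mod⇒%≡ p) (m<n⇒m%n≡m r<n)))

module Coordinates (m M : ℕ) .{{_ : NonZero m}} .{{_ : NonZero M}} where
  open ZZ m M

  π₁ π₂ : G → ℕ
  π₁ = toℕ ∘ proj₁
  π₂ = toℕ ∘ proj₂

  π₁-elt : ∀ i j → π₁ (elt i j) ≡ i [mod m ]
  π₁-elt i j = mod-trans (mod-reflexive (toℕ-fromℕ< _)) (mod-% i)

  π₂-elt : ∀ i j → π₂ (elt i j) ≡ j [mod M ]
  π₂-elt i j = mod-trans (mod-reflexive (toℕ-fromℕ< _)) (mod-% j)

  elt-π : ∀ g → elt (π₁ g) (π₂ g) ≡ g
  elt-π (x , y) = cong₂ _,_ (toℕ-injective (trans (toℕ-fromℕ< _) (m<n⇒m%n≡m (toℕ<n x))))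
                            (toℕ-injective (trans (toℕ-fromℕ< _) (m<n⇒m%n≡m (toℕ<n y))))

  elt-cong : ∀ {i j i′ j′} → i ≡ i′ [mod m ] → j ≡ j′ [mod M ] → elt i j ≡ elt i′ j′
  elt-cong p q = cong₂ _,_
    (toℕ-injective (trans (toℕ-fromℕ< _) (trans (mod⇒%≡ p) (sym (toℕ-fromℕ< _)))))
    (toℕ-injective (trans (toℕ-fromℕ< _) (trans (mod⇒%≡ q) (sym (toℕ-fromℕ< _)))))

  elt-injective : ∀ {i j i′ j′} → elt i j ≡ elt i′ j′ → i ≡ i′ [mod m ] × j ≡ j′ [mod M ]
  elt-injective {i} {j} {i′} {j′} e =
    mod-trans (mod-sym (π₁-elt i j)) (mod-trans (mod-reflexive (cong π₁ e)) (π₁-elt i′ j′)) ,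
    mod-trans (mod-sym (π₂-elt i j)) (mod-trans (mod-reflexive (cong π₂ e)) (π₂-elt i′ j′))

  ⊕-elt : ∀ i j k l → elt i j ⊕ elt k l ≡ elt (i + k) (j + l)
  ⊕-elt i j k l = elt-cong (mod-+ (π₁-elt i j) (π₁-elt k l)) (mod-+ (π₂-elt i j) (π₂-elt k l))

  ·-elt : ∀ k i j → k · elt i j ≡ elt (k * i) (k * j)
  ·-elt zero    i j = refl
  ·-elt (suc k) i j = trans (cong (elt i j ⊕_) (·-elt k i j)) (⊕-elt i j (k * i) (k * j))

  ⊕-comm : ∀ g h → g ⊕ h ≡ h ⊕ g
  ⊕-comm (x , y) (a , b) = cong₂ _,_ (cong (_mod m) (+-comm (toℕ x) (toℕ a))) (cong (_mod M) (+-comm (toℕ y) (toℕ b)))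

  elt-≢-0G : ∀ i {j} → 0 < j → j < M → ¬ elt i j ≡ 0G
  elt-≢-0G i {j} 0<j j<M e = <⇒≢ 0<j (sym (mod⇒≡ (proj₂ (elt-injective e)) j<M (>-nonZero⁻¹ M)))

  -- If g generated, (1,0) = k g and (0,1) = k′ g would give 1 ≡ k g₁ · k′ g₂ = k′ g₁ · k g₂ ≡ 0 mod m.
  noncyclic : 2 ≤ m → m ∣ M → NonCyclic
  noncyclic 2≤m m∣M (g , generates) with generates (elt 1 0) | generates (elt 0 1)
  ... | k , kg≡10 | k′ , k′g≡01 = contradiction (mod⇒≡ 1≡0 2≤m (>-nonZero⁻¹ m)) λ ()
    where
    open ModReasoning m
    multiple : ∀ k → k · g ≡ elt (k * π₁ g) (k * π₂ g)
    multiple k = trans (cong (k ·_) (sym (elt-π g))) (·-elt k (π₁ g) (π₂ g))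
    k-eqs  = elt-injective (trans (sym (multiple k)) kg≡10)
    k′-eqs = elt-injective (trans (sym (multiple k′)) k′g≡01)
    commute : ∀ k g₁ k′ g₂ → (k * g₁) * (k′ * g₂) ≡ (k′ * g₁) * (k * g₂)
    commute = solve-∀
    1≡0 : 1 ≡ 0 [mod m ]
    1≡0 = begin
      1                                    ≈⟨ mod-* (mod-sym (proj₁ k-eqs)) (mod-sym (mod-∣ m∣M (proj₂ k′-eqs))) ⟩
      (k * π₁ g) * (k′ * π₂ g)             ≡⟨ commute k (π₁ g) k′ (π₂ g) ⟩
      (k′ * π₁ g) * (k * π₂ g)             ≈⟨ mod-* (proj₁ k′-eqs) mod-refl ⟩
      0                                    ∎

  translate : G → ℕ → ℕ → G
  translate u x y = elt (π₁ u + x) (π₂ u + y)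

  translate-zero : ∀ u → translate u 0 0 ≡ u
  translate-zero u = trans (cong₂ elt (+-identityʳ (π₁ u)) (+-identityʳ (π₂ u))) (elt-π u)

  translate-+ : ∀ u x y x′ y′ → translate u (x + x′) (y + y′) ≡ translate (translate u x y) x′ y′
  translate-+ u x y x′ y′ = elt-cong
    (mod-trans (mod-reflexive (sym (+-assoc (π₁ u) x x′))) (mod-+ (mod-sym (π₁-elt (π₁ u + x) (π₂ u + y))) mod-refl))
    (mod-trans (mod-reflexive (sym (+-assoc (π₂ u) y y′))) (mod-+ (mod-sym (π₂-elt (π₁ u + x) (π₂ u + y))) mod-refl))

  ⊕-translate : ∀ u x y → u ⊕ elt x y ≡ translate u x y
  ⊕-translate u x y = trans (cong (_⊕ elt x y) (sym (elt-π u))) (⊕-elt (π₁ u) (π₂ u) x y)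

  module Generators (a₁ a₂ b₁ b₂ : ℕ) where

    a b : G
    a = elt a₁ a₂
    b = elt b₁ b₂

    shift : G → ℕ → ℕ → G
    shift u i j = translate u (i * a₁ + j * b₁) (i * a₂ + j * b₂)

    shift-sucˡ : ∀ u i j → shift u (suc i) j ≡ shift (u ⊕ a) i j
    shift-sucˡ u i j = trans
      (cong₂ (translate u) (+-assoc a₁ (i * a₁) (j * b₁)) (+-assoc a₂ (i * a₂) (j * b₂)))
      (trans (translate-+ u a₁ a₂ _ _) (cong (λ w → translate w _ _) (sym (⊕-translate u a₁ a₂))))

    shift-sucʳ : ∀ u i j → shift u i (suc j) ≡ shift (u ⊕ b) i j
    shift-sucʳ u i j = trans
      (cong₂ (translate u) (front i a₁ b₁ j) (front i a₂ b₂ j))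
      (trans (translate-+ u b₁ b₂ _ _) (cong (λ w → translate w _ _) (sym (⊕-translate u b₁ b₂))))
      where
      front : ∀ i a b j → i * a + (b + j * b) ≡ b + (i * a + j * b)
      front = solve-∀

    walk⇒shift : ∀ {u v k} → Walk a b u v k → ∃₂ λ i j → i + j ≡ k × shift u i j ≡ v
    walk⇒shift {u} here = 0 , 0 , refl , translate-zero u
    walk⇒shift {u} (stepA w) with walk⇒shift w
    ... | i , j , refl , p = suc i , j , refl , trans (shift-sucˡ u i j) p
    walk⇒shift {u} (stepB w) with walk⇒shift w
    ... | i , j , refl , p = i , suc j , +-suc i j , trans (shift-sucʳ u i j) p

    shift⇒walk : ∀ {u v} i j → shift u i j ≡ v → Walk a b u v (i + j)
    shift⇒walk {u} (suc i) j    p = stepA (shift⇒walk i j (trans (sym (shift-sucˡ u i j)) p))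
    shift⇒walk {u} zero (suc j) p = stepB (shift⇒walk 0 j (trans (sym (shift-sucʳ u 0 j)) p))
    shift⇒walk {u} zero zero    p = subst (λ w → Walk a b u w 0) (trans (sym (translate-zero u)) p) here

    Covers : ℕ → Set
    Covers D = ∀ x₁ x₂ → ∃₂ λ i j →
      i + j ≤ D × i * a₁ + j * b₁ ≡ x₁ [mod m ] × i * a₂ + j * b₂ ≡ x₂ [mod M ]

    Far : ℕ → ℕ → ℕ → Set
    Far D i₀ j₀ = ∀ i j →
      i * a₁ + j * b₁ ≡ i₀ * a₁ + j₀ * b₁ [mod m ] → i * a₂ + j * b₂ ≡ i₀ * a₂ + j₀ * b₂ [mod M ] → D ≤ i + j

    covers⇒generates : ∀ {D} → Covers D → Generates a b
    covers⇒generates cover x with cover (π₁ x) (π₂ x)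
    ... | i , j , _ , p₁ , p₂ = i , j , (begin
      (i · a) ⊕ (j · b)                             ≡⟨ cong₂ _⊕_ (·-elt i a₁ a₂) (·-elt j b₁ b₂) ⟩
      elt (i * a₁) (i * a₂) ⊕ elt (j * b₁) (j * b₂)  ≡⟨ ⊕-elt _ _ _ _ ⟩
      elt (i * a₁ + j * b₁) (i * a₂ + j * b₂)        ≡⟨ elt-cong p₁ p₂ ⟩
      elt (π₁ x) (π₂ x)                             ≡⟨ elt-π x ⟩
      x                                             ∎)
      where open ≡-Reasoning

    covers∧far⇒isDiameter : ∀ {D i₀ j₀} → Covers D → Far D i₀ j₀ → IsDiameter a b D
    covers∧far⇒isDiameter {D} {i₀} {j₀} cover far = reach , 0G , shift 0G i₀ j₀ , unreachable
      where
      reach : ∀ u v → ∃[ k ] (k ≤ D × Walk a b u v k)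
      -- the coordinates of v − u
      reach u v with cover (π₁ v + (m ∸ π₁ u)) (π₂ v + (M ∸ π₂ u))
      ... | i , j , i+j≤D , p₁ , p₂ = i + j , i+j≤D , shift⇒walk i j (trans (elt-cong
        (mod-trans (mod-+ (mod-refl {a = π₁ u}) p₁) (mod-+-∸ (π₁ u) (π₁ v) (<⇒≤ (toℕ<n (proj₁ u)))))
        (mod-trans (mod-+ (mod-refl {a = π₂ u}) p₂) (mod-+-∸ (π₂ u) (π₂ v) (<⇒≤ (toℕ<n (proj₂ u))))))
        (elt-π v))

      unreachable : ∀ k → k < D → ¬ Walk a b 0G (shift 0G i₀ j₀) k
      unreachable k k<D w with walk⇒shift w
      ... | i , j , refl , p =
        <⇒≱ k<D (far i j (mod-+-cancelˡ (π₁ 0G) (proj₁ same)) (mod-+-cancelˡ (π₂ 0G) (proj₂ same)))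
        where same = elt-injective p

module _ (m′ M′ : ℕ) where
  open ZZ (suc m′) (suc M′)
  open Coordinates (suc m′) (suc M′)

  tightCay-criterion : ∀ {a₁ a₂ b₁ b₂ D} i₀ j₀ → let open Generators a₁ a₂ b₁ b₂ in
    2 ≤ suc m′ → suc m′ ∣ suc M′ →
    0 < a₂ → a₂ < suc M′ → 0 < b₂ → b₂ < suc M′ →
    (∀ c → IsCeilSqrt (3 * (suc m′ * suc M′)) c → c ∸ 2 ≡ D) →
    Covers D → Far D i₀ j₀ →
    TightCay (suc m′) (suc M′) a₁ a₂ b₁ b₂
  tightCay-criterion {a₁} {a₂} {b₁} {b₂} i₀ j₀ 2≤m m∣M 0<a₂ a₂<M 0<b₂ b₂<M diameter cover far =
    elt-≢-0G a₁ 0<a₂ a₂<M , elt-≢-0G b₁ 0<b₂ b₂<M , covers⇒generates cover , noncyclic 2≤m m∣M ,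
    λ c isCeil → subst (IsDiameter a b) (sym (diameter c isCeil)) (covers∧far⇒isDiameter {i₀ = i₀} {j₀} cover far)
    where open Generators a₁ a₂ b₁ b₂

  swap-walk : ∀ {a b u v k} → Walk a b u v k → Walk b a u v k
  swap-walk here      = here
  swap-walk (stepA w) = stepB (swap-walk w)
  swap-walk (stepB w) = stepA (swap-walk w)

  swap-isDiameter : ∀ {a b D} → IsDiameter a b D → IsDiameter b a D
  swap-isDiameter (reach , u , v , unreachable) =
    (λ x y → let k , k≤D , w = reach x y in k , k≤D , swap-walk w) ,
    u , v , λ k k<D w → unreachable k k<D (swap-walk w)

  swap-generates : ∀ {a b} → Generates a b → Generates b a
  swap-generates {a} {b} generates x = let i , j , e = generates x in j , i , trans (⊕-comm (j · b) (i · a)) e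

swap-tightCay : ∀ m M {a₁ a₂ b₁ b₂} → TightCay m M a₁ a₂ b₁ b₂ → TightCay m M b₁ b₂ a₁ a₂
swap-tightCay (suc m′) (suc M′) (a≢0 , b≢0 , generates , noncyclic , diameter) =
  b≢0 , a≢0 , swap-generates m′ M′ generates , noncyclic , λ c isCeil → swap-isDiameter m′ M′ (diameter c isCeil)

isCeilSqrt-unique : ∀ {X K c} → K * K < X → X ≤ suc K * suc K → IsCeilSqrt X c → c ≡ suc K
isCeilSqrt-unique {X} {K} {c} K²<X X≤[1+K]² (X≤c² , least) = ≤-antisym (least (suc K) X≤[1+K]²) (≮⇒≥ c≯K)
  where
  c≯K : ¬ c < suc K
  c≯K c<1+K = <⇒≱ K²<X (≤-trans X≤c² (*-mono-≤ c≤K c≤K))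
    where c≤K = s≤s⁻¹ c<1+K

-- With 3N = K₀² − δ, scaling the order by m² keeps ⌈√·⌉ exact as long as m²δ stays below 2mK₀ − 1.
isCeilSqrt-scaled : ∀ m′ {N δ k} → 2 ≤ suc m′ → 3 * N + δ ≡ suc k * suc k → suc m′ * δ + 1 ≤ 2 * suc k →
  ∀ c → IsCeilSqrt (3 * (suc m′ * (suc m′ * N))) c → c ≡ suc m′ * suc k
isCeilSqrt-scaled m′ {N} {δ} {k} 2≤m square δ-small c = isCeilSqrt-unique K²<X X≤[1+K]²
  where
  m = suc m′
  K = k + m′ * suc k
  X = 3 * (m * (m * N))
  X+m²δ : X + m * (m * δ) ≡ suc K * suc K
  X+m²δ = trans (scale m N δ) (trans (cong (λ y → m * (m * y)) square) (regroup m (suc k)))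
    where
    scale : ∀ m N δ → 3 * (m * (m * N)) + m * (m * δ) ≡ m * (m * (3 * N + δ))
    scale = solve-∀
    regroup : ∀ m k → m * (m * (k * k)) ≡ m * k * (m * k)
    regroup = solve-∀
  X≤[1+K]² : X ≤ suc K * suc K
  X≤[1+K]² = subst (X ≤_) X+m²δ (m≤m+n X _)
  m²δ≤2K : m * (m * δ) ≤ 2 * K
  m²δ≤2K = +-cancelʳ-≤ 2 _ _ (begin
    m * (m * δ) + 2      ≤⟨ +-monoʳ-≤ (m * (m * δ)) 2≤m ⟩
    m * (m * δ) + m      ≡⟨ distrib m δ ⟩
    m * (m * δ + 1)      ≤⟨ *-monoʳ-≤ m δ-small ⟩
    m * (2 * suc k)      ≡⟨ double m′ k ⟩
    2 * K + 2            ∎)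
    where
    open ≤-Reasoning
    distrib : ∀ m δ → m * (m * δ) + m ≡ m * (m * δ + 1)
    distrib = solve-∀
    double : ∀ m′ k → suc m′ * (2 * suc k) ≡ 2 * (k + m′ * suc k) + 2
    double = solve-∀
  K²<X : K * K < X
  K²<X = +-cancelʳ-≤ (m * (m * δ)) _ X (begin
    suc (K * K) + m * (m * δ) ≤⟨ +-monoʳ-≤ (suc (K * K)) m²δ≤2K ⟩
    suc (K * K) + 2 * K       ≡⟨ square-suc K ⟩
    suc K * suc K             ≡⟨ sym X+m²δ ⟩
    X + m * (m * δ)           ∎)
    where
    open ≤-Reasoning
    square-suc : ∀ K → suc (K * K) + 2 * K ≡ suc K * suc K
    square-suc = solve-∀

m*n+o≢m*m : ∀ m n o → 0 < o → o ≤ n → m * n + o ≢ m * m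
m*n+o≢m*m m n o 0<o o≤n eq with m ≤? n
... | yes m≤n = <⇒≢ (begin-strict
  m * m       ≤⟨ *-monoʳ-≤ m m≤n ⟩
  m * n       <⟨ m<m+n (m * n) 0<o ⟩
  m * n + o   ∎) (sym eq)
  where open ≤-Reasoning
... | no m≰n = <⇒≱ (≰⇒> m≰n) (≤-trans m≤o o≤n)
  where
  open ≤-Reasoning
  m≤o : m ≤ o
  m≤o = +-cancelˡ-≤ (m * n) m o (begin
    m * n + m     ≡⟨ +-comm (m * n) m ⟩
    m + m * n     ≡⟨ sym (*-suc m n) ⟩
    m * suc n     ≤⟨ *-monoʳ-≤ m (≰⇒> m≰n) ⟩
    m * m         ≡⟨ sym eq ⟩
    m * n + o     ∎)

-- Cay(Z_N, {t, 2t+1}) with t = s + 1: its diameter is D = 3t + c − 1, attained at the residue of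
-- T, the lattice point (2t , t − 1 + c).
module Cyclic (s c : ℕ) where

  t B N D T : ℕ
  t = suc s
  B = 2 * t + 1
  N = 3 * t * t + 2 * t + c * B
  D = 2 * t + (s + c)
  T = t * (2 * t) + B * (s + c)

  N+t²≡B[2t+c] : N + t * t ≡ B * (2 * t + c)
  N+t²≡B[2t+c] = identity t c
    where
    identity : ∀ t c → 3 * t * t + 2 * t + c * (2 * t + 1) + t * t ≡ (2 * t + 1) * (2 * t + c)
    identity = solve-∀

  s+[2t+c]≡D : s + (2 * t + c) ≡ D
  s+[2t+c]≡D = identity s (2 * t) c
    where
    identity : ∀ s x c → s + (x + c) ≡ x + (s + c)
    identity = solve-∀

  Near : ℕ → Set
  Near z = ∃₂ λ i j → i + j ≤ D × t * i + B * j ≡ z [mod N ]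

  2*-mono-< : ∀ {g} → g < t → 2 * g + 2 ≤ 2 * t
  2*-mono-< {g} g<t = subst (_≤ 2 * t) (twice g) (*-monoʳ-≤ 2 g<t)
    where
    twice : ∀ g → 2 * suc g ≡ 2 * g + 2
    twice = solve-∀

  -- 2t ≡ −1 (mod 2t+1), so t is invertible modulo B.
  residue-as-t-multiple : ∀ r → r < B → ∃₂ λ i₀ g → i₀ ≤ 2 * t × g < t × t * i₀ ≡ r + B * g
  residue-as-t-multiple zero _ = 0 , 0 , z≤n , z<s , trans (*-zeroʳ t) (sym (*-zeroʳ B))
  residue-as-t-multiple (suc r) r<B with suc r ≤? t
  ... | yes 1+r≤t = 2 * g + 1 , g , ≤-trans (+-monoʳ-≤ (2 * g) (s≤s z≤n)) (2*-mono-< g<t) , g<t ,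
                    subst (λ x → x * (2 * g + 1) ≡ suc r + (2 * x + 1) * g) r+g≡t (identity r g)
    where
    g = proj₁ (m≤n⇒∃[o]m+o≡n 1+r≤t)
    r+g≡t = proj₂ (m≤n⇒∃[o]m+o≡n 1+r≤t)
    g<t : g < t
    g<t = subst (g <_) r+g≡t (s≤s (m≤n+m g r))
    identity : ∀ r g → (suc r + g) * (2 * g + 1) ≡ suc r + (2 * (suc r + g) + 1) * g
    identity = solve-∀
  ... | no 1+r≰t = 2 * g + 2 , g , 2*-mono-< g<t , g<t ,
                   subst (λ y → t * (2 * g + 2) ≡ suc y + B * g) t+e≡r
                     (subst (λ x → x * (2 * g + 2) ≡ suc (x + e) + (2 * x + 1) * g) e+g≡t (identity e g))
    where
    t≤r = s≤s⁻¹ (≰⇒> 1+r≰t)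
    e = proj₁ (m≤n⇒∃[o]m+o≡n t≤r)
    t+e≡r = proj₂ (m≤n⇒∃[o]m+o≡n t≤r)
    1+e≤t : suc e ≤ t
    1+e≤t = +-cancelˡ-≤ t (suc e) t (begin
      t + suc e   ≡⟨ trans (+-suc t e) (cong suc t+e≡r) ⟩
      suc r       ≤⟨ s≤s⁻¹ (subst (suc (suc r) ≤_) (+-comm (2 * t) 1) r<B) ⟩
      2 * t       ≡⟨ cong (t +_) (+-identityʳ t) ⟩
      t + t       ∎)
      where open ≤-Reasoning
    g = proj₁ (m≤n⇒∃[o]m+o≡n 1+e≤t)
    e+g≡t = proj₂ (m≤n⇒∃[o]m+o≡n 1+e≤t)
    g<t : g < t
    g<t = subst (g <_) e+g≡t (s≤s (m≤n+m g e))
    identity : ∀ e g → (suc e + g) * (2 * g + 2) ≡ suc ((suc e + g) + e) + (2 * (suc e + g) + 1) * g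
    identity = solve-∀

  -- B(i + j) = (ti + Bj) + (t+1)i < B(2t+c) − t² + 2t(t+1) ≤ B(3t+c).
  ti+Bj<N⇒i+j≤D : ∀ i j → i ≤ 2 * t → t * i + B * j < N → i + j ≤ D
  ti+Bj<N⇒i+j≤D i j i≤2t small = s≤s⁻¹ (*-cancelˡ-< B (i + j) (suc D) (+-cancelʳ-< (t * t) _ _ (begin-strict
    B * (i + j) + t * t                       ≡⟨ split t i j ⟩
    t * i + B * j + t * t + suc t * i         <⟨ +-monoˡ-< (suc t * i) (+-monoˡ-< (t * t) small) ⟩
    N + t * t + suc t * i                     ≤⟨ +-monoʳ-≤ (N + t * t) (*-monoʳ-≤ (suc t) i≤2t) ⟩
    N + t * t + suc t * (2 * t)               ≤⟨ m≤m+n _ (s * t) ⟩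
    N + t * t + suc t * (2 * t) + s * t       ≡⟨ identity s c ⟩
    B * suc D + t * t                         ∎)))
    where
    open ≤-Reasoning
    split : ∀ t i j → (2 * t + 1) * (i + j) + t * t ≡ t * i + (2 * t + 1) * j + t * t + suc t * i
    split = solve-∀
    identity : ∀ s c → 3 * suc s * suc s + 2 * suc s + c * (2 * suc s + 1) + suc s * suc s
                         + suc (suc s) * (2 * suc s) + s * suc s
                       ≡ (2 * suc s + 1) * suc (2 * suc s + (s + c)) + suc s * suc s
    identity = solve-∀

  near-via-z+N : ∀ {z} i j d → i + j ≤ D →
    t * i + B * j + (B * suc d + t * t) ≡ z + B * suc d + (N + t * t) → Near z
  near-via-z+N {z} i j d i+j≤D equation = i , j , i+j≤D ,
    mod-trans (mod-reflexive (+-cancelʳ-≡ _ _ _ (trans equation (regroup z (B * suc d) N (t * t)))))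
              (mod-+-modulus z)
    where
    regroup : ∀ z x N y → z + x + (N + y) ≡ z + N + (x + y)
    regroup = solve-∀

  -- We represent z + N: as N + t² = B(2t+c), the deficit B(d+1) is paid by the B-coefficient and t² by the
  -- t-coefficient, as t·t when i₀ ≥ t and as B·t − t(t+1) otherwise.
  near-of-deficit : ∀ z i₀ d → i₀ ≤ 2 * t → suc d < t → z + B * suc d ≡ t * i₀ → Near z
  near-of-deficit z i₀ d i₀≤2t d<t deficit with t ≤? i₀
  ... | yes t≤i₀ = near-via-z+N e j d bound (begin
    t * e + B * j + (B * suc d + t * t)  ≡⟨ identity t e j d ⟩
    t * (t + e) + B * (suc d + j)        ≡⟨ cong₂ (λ x y → t * x + B * y) t+e≡i₀ d+j≡2t+c ⟩
    t * i₀ + B * (2 * t + c)             ≡⟨ cong₂ _+_ (sym deficit) (sym N+t²≡B[2t+c]) ⟩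
    z + B * suc d + (N + t * t)          ∎)
    where
    open ≡-Reasoning
    e = proj₁ (m≤n⇒∃[o]m+o≡n t≤i₀)
    t+e≡i₀ = proj₂ (m≤n⇒∃[o]m+o≡n t≤i₀)
    1+d≤2t+c : suc d ≤ 2 * t + c
    1+d≤2t+c = ≤-trans (<⇒≤ d<t) (≤-trans (m≤n*m t 2) (m≤m+n (2 * t) c))
    j = proj₁ (m≤n⇒∃[o]m+o≡n 1+d≤2t+c)
    d+j≡2t+c = proj₂ (m≤n⇒∃[o]m+o≡n 1+d≤2t+c)
    e≤t : e ≤ t
    e≤t = +-cancelˡ-≤ t e t (subst₂ _≤_ (sym t+e≡i₀) (cong (t +_) (+-identityʳ t)) i₀≤2t)
    bound : e + j ≤ D
    bound = s≤s⁻¹ (subst₂ _≤_ (+-suc e j) (cong suc s+[2t+c]≡D)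
              (+-mono-≤ e≤t (subst (suc j ≤_) d+j≡2t+c (s≤s (m≤n+m j d)))))
    identity : ∀ t e j d → t * e + (2 * t + 1) * j + ((2 * t + 1) * suc d + t * t)
                         ≡ t * (t + e) + (2 * t + 1) * (suc d + j)
    identity = solve-∀
  ... | no t≰i₀ = near-via-z+N (i₀ + suc t) j d bound (begin
    t * (i₀ + suc t) + B * j + (B * suc d + t * t)  ≡⟨ identity t i₀ j d ⟩
    t * i₀ + B * (suc d + t + j)                    ≡⟨ cong (λ y → t * i₀ + B * y) d+t+j≡2t+c ⟩
    t * i₀ + B * (2 * t + c)                        ≡⟨ cong₂ _+_ (sym deficit) (sym N+t²≡B[2t+c]) ⟩
    z + B * suc d + (N + t * t)                     ∎)
    where
    open ≡-Reasoning
    i₀≤s : i₀ ≤ s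
    i₀≤s = s≤s⁻¹ (≰⇒> t≰i₀)
    1+d+t≤2t+c : suc d + t ≤ 2 * t + c
    1+d+t≤2t+c = ≤-trans (+-monoˡ-≤ t (<⇒≤ d<t)) (subst (t + t ≤_) (cong (λ x → x + c) (cong (t +_) (sym (+-identityʳ t))))
                   (m≤m+n (t + t) c))
    j = proj₁ (m≤n⇒∃[o]m+o≡n 1+d+t≤2t+c)
    d+t+j≡2t+c = proj₂ (m≤n⇒∃[o]m+o≡n 1+d+t≤2t+c)
    bound : i₀ + suc t + j ≤ D
    bound = subst₂ _≤_ (sym (+-assoc i₀ (suc t) j)) s+[2t+c]≡D
              (+-mono-≤ i₀≤s (subst (suc t + j ≤_) d+t+j≡2t+c (s≤s (+-monoˡ-≤ j (m≤n+m t d)))))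
    identity : ∀ t i₀ j d → t * (i₀ + suc t) + (2 * t + 1) * j + ((2 * t + 1) * suc d + t * t)
                          ≡ t * i₀ + (2 * t + 1) * (suc d + t + j)
    identity = solve-∀

  near-below-N : ∀ z → z < N → Near z
  near-below-N z z<N with residue-as-t-multiple (z % B) (m%n<n z B)
  ... | i₀ , g , i₀≤2t , g<t , ti₀≡r+Bg with g ≤? z / B
  ...   | yes g≤u = i₀ , j , ti+Bj<N⇒i+j≤D i₀ j i₀≤2t (subst (_< N) z≡ti₀+Bj z<N) , mod-reflexive (sym z≡ti₀+Bj)
    where
    open ≡-Reasoning
    j = proj₁ (m≤n⇒∃[o]m+o≡n g≤u)
    g+j≡u = proj₂ (m≤n⇒∃[o]m+o≡n g≤u)
    regroup : ∀ r g j B → r + (g + j) * B ≡ r + B * g + B * j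
    regroup = solve-∀
    z≡ti₀+Bj : z ≡ t * i₀ + B * j
    z≡ti₀+Bj = begin
      z                        ≡⟨ m≡m%n+[m/n]*n z B ⟩
      z % B + (z / B) * B      ≡⟨ cong (λ u → z % B + u * B) (sym g+j≡u) ⟩
      z % B + (g + j) * B      ≡⟨ regroup (z % B) g j B ⟩
      z % B + B * g + B * j    ≡⟨ cong (_+ B * j) (sym ti₀≡r+Bg) ⟩
      t * i₀ + B * j           ∎
  ...   | no g≰u = near-of-deficit z i₀ d i₀≤2t (≤-<-trans (subst (suc d ≤_) u+d≡g (s≤s (m≤n+m d u))) g<t) (begin
      z + B * suc d                ≡⟨ cong (_+ B * suc d) (m≡m%n+[m/n]*n z B) ⟩
      z % B + (z / B) * B + B * suc d  ≡⟨ regroup (z % B) (z / B) d B ⟩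
      z % B + B * (suc (z / B) + d)    ≡⟨ cong (λ x → z % B + B * x) u+d≡g ⟩
      z % B + B * g                    ≡⟨ sym ti₀≡r+Bg ⟩
      t * i₀                           ∎)
    where
    open ≡-Reasoning
    u = z / B
    d = proj₁ (m≤n⇒∃[o]m+o≡n (≰⇒> g≰u))
    u+d≡g : suc u + d ≡ g
    u+d≡g = proj₂ (m≤n⇒∃[o]m+o≡n (≰⇒> g≰u))
    regroup : ∀ r u d B → r + u * B + B * suc d ≡ r + B * (suc u + d)
    regroup = solve-∀

  near : ∀ z → Near z
  near z = let i , j , i+j≤D , p = near-below-N (z % N) (m%n<n z N) in i , j , i+j≤D , mod-trans p (mod-% z)

  -- t divides δ; with δ = qt the equation becomes i + Bq = 2t, impossible both for q = 0 and for q > 0.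
  2t²-unreachable : ∀ i δ → i + δ < 2 * t → t * i + B * δ ≢ t * (2 * t)
  2t²-unreachable i δ i+δ<2t eq
    with ∣m+n∣m⇒∣n (divides (2 * t) (trans (regroup t i δ) (trans eq (*-comm t (2 * t))))) (m∣m*n (i + 2 * δ))
    where
    regroup : ∀ t i δ → t * (i + 2 * δ) + δ ≡ t * i + (2 * t + 1) * δ
    regroup = solve-∀
  ... | divides zero refl = <⇒≢ (subst (_< 2 * t) (+-identityʳ i) i+δ<2t)
    (*-cancelˡ-≡ i (2 * t) t (trans (sym (trans (cong (t * i +_) (*-zeroʳ B)) (+-identityʳ (t * i)))) eq))
  ... | divides (suc q) refl = contradiction (begin-strict
    B                    ≤⟨ m≤m*n B (suc q) ⟩
    B * suc q            ≤⟨ m≤n+m (B * suc q) i ⟩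
    i + B * suc q        ≡⟨ *-cancelˡ-≡ _ _ t (trans (regroup t i B (suc q)) eq) ⟩
    2 * t                <⟨ n<1+n (2 * t) ⟩
    suc (2 * t)          ∎) (<-irrefl (+-comm (2 * t) 1))
    where
    open ≤-Reasoning
    regroup : ∀ t i B q → t * (i + B * q) ≡ t * i + B * (q * t)
    regroup = solve-∀

  T-unreachable-below-D : ∀ i j → i + j < D → t * i + B * j ≢ T
  T-unreachable-below-D i j i+j<D eq with s + c ≤? j
  ... | yes s+c≤j with m≤n⇒∃[o]m+o≡n s+c≤j
  ...   | δ , refl = 2t²-unreachable i δ i+δ<2t (+-cancelʳ-≡ (B * (s + c)) _ _ (trans (regroup t i B (s + c) δ) eq))
    where
    regroup : ∀ t i B x δ → t * i + B * δ + B * x ≡ t * i + B * (x + δ)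
    regroup = solve-∀
    regroup′ : ∀ i x δ → i + (x + δ) ≡ i + δ + x
    regroup′ = solve-∀
    i+δ<2t : i + δ < 2 * t
    i+δ<2t = +-cancelʳ-< (s + c) (i + δ) (2 * t) (subst (_< 2 * t + (s + c)) (regroup′ i (s + c) δ) i+j<D)
  T-unreachable-below-D i j i+j<D eq | no s+c≰j = <⇒≢ (begin-strict
      t * i                      ≤⟨ *-monoʳ-≤ t i≤2t+δ ⟩
      t * (2 * t + δ)            ≡⟨ *-distribˡ-+ t (2 * t) δ ⟩
      t * (2 * t) + t * δ        <⟨ +-monoʳ-< (t * (2 * t)) tδ<B[1+δ] ⟩
      t * (2 * t) + B * suc δ    ∎) ti≡t2t+B[1+δ]
    where
    open ≤-Reasoning
    δ = proj₁ (m≤n⇒∃[o]m+o≡n (≰⇒> s+c≰j))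
    j+δ≡s+c : suc j + δ ≡ s + c
    j+δ≡s+c = proj₂ (m≤n⇒∃[o]m+o≡n (≰⇒> s+c≰j))
    regroup : ∀ x B j δ → x + B * (suc j + δ) ≡ x + B * suc δ + B * j
    regroup = solve-∀
    ti≡t2t+B[1+δ] : t * i ≡ t * (2 * t) + B * suc δ
    ti≡t2t+B[1+δ] = +-cancelʳ-≡ (B * j) _ _
      (trans eq (trans (cong (λ y → t * (2 * t) + B * y) (sym j+δ≡s+c)) (regroup (t * (2 * t)) B j δ)))
    regroup′ : ∀ x j δ → x + (suc j + δ) ≡ suc (x + δ) + j
    regroup′ = solve-∀
    i≤2t+δ : i ≤ 2 * t + δ
    i≤2t+δ = s≤s⁻¹ (+-cancelʳ-< j i (suc (2 * t + δ))
      (subst (i + j <_) (trans (cong (2 * t +_) (sym j+δ≡s+c)) (regroup′ (2 * t) j δ)) i+j<D))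
    tδ<B[1+δ] : t * δ < B * suc δ
    tδ<B[1+δ] = begin-strict
      t * δ        ≤⟨ *-monoˡ-≤ δ (≤-trans (m≤n*m t 2) (m≤m+n (2 * t) 1)) ⟩
      B * δ        <⟨ *-monoʳ-< B (n<1+n δ) ⟩
      B * suc δ    ∎

  -- T − N = t² − 3t − 1 would force t(i + 2j + 3) + (j + 1) = t².
  T-N-unreachable : ∀ i j → t * i + B * j + N ≢ T
  T-N-unreachable i j eq = m*n+o≢m*m t (i + 2 * j + 3) (suc j) (s≤s z≤n)
    (subst (suc j ≤_) (pad i j) (m≤n+m (suc j) (i + j + 2)))
    (+-cancelʳ-≡ T _ _ (trans (identity s c i j) (trans (cong (_+ t * t) eq) (+-comm T (t * t)))))
    where
    pad : ∀ i j → i + j + 2 + suc j ≡ i + 2 * j + 3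
    pad = solve-∀
    identity : ∀ s c i j →
      suc s * (i + 2 * j + 3) + suc j + (suc s * (2 * suc s) + (2 * suc s + 1) * (s + c))
      ≡ suc s * i + (2 * suc s + 1) * j + (3 * suc s * suc s + 2 * suc s + c * (2 * suc s + 1)) + suc s * suc s
    identity = solve-∀

  short-below-T+N : ∀ i j → i + j < D → t * i + B * j < T + N
  short-below-T+N i j i+j<D = begin-strict
    t * i + B * j          ≤⟨ +-monoˡ-≤ (B * j) (*-monoˡ-≤ i (≤-trans (m≤n*m t 2) (m≤m+n (2 * t) 1))) ⟩
    B * i + B * j          ≡⟨ sym (*-distribˡ-+ B i j) ⟩
    B * (i + j)            <⟨ *-monoʳ-< B i+j<D ⟩
    B * D                  ≤⟨ m≤m+n (B * D) (t * t + c * B) ⟩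
    B * D + (t * t + c * B) ≡⟨ identity s c ⟩
    T + N                  ∎
    where
    open ≤-Reasoning
    identity : ∀ s c → (2 * suc s + 1) * (2 * suc s + (s + c)) + (suc s * suc s + c * (2 * suc s + 1))
                     ≡ suc s * (2 * suc s) + (2 * suc s + 1) * (s + c) + (3 * suc s * suc s + 2 * suc s + c * (2 * suc s + 1))
    identity = solve-∀

  T<2N : T < N + N
  T<2N = subst (T <_) (identity s c) (m<m+n T (s≤s z≤n))
    where
    identity : ∀ s c → suc s * (2 * suc s) + (2 * suc s + 1) * (s + c) + suc (2 * suc s * suc s + 5 * suc s + c * (2 * suc s + 1))
                     ≡ (3 * suc s * suc s + 2 * suc s + c * (2 * suc s + 1)) + (3 * suc s * suc s + 2 * suc s + c * (2 * suc s + 1))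
    identity = solve-∀

  farthest : ∀ i j → t * i + B * j ≡ T [mod N ] → D ≤ i + j
  farthest i j p = ≮⇒≥ λ i+j<D → case mod-below p (short-below-T+N i j i+j<D) of λ where
    (zero , eq)        → T-unreachable-below-D i j i+j<D (trans (sym (+-identityʳ _)) eq)
    (suc zero , eq)    → T-N-unreachable i j (trans (cong (t * i + B * j +_) (sym (+-identityʳ N))) eq)
    (suc (suc q) , eq) → <⇒≱ T<2N
      (subst (N + N ≤_) eq (≤-trans (+-monoʳ-≤ N (m≤m+n N (q * N))) (m≤n+m _ (t * i + B * j))))

-- (i , j) ↦ (i + 2j , t i + (2t+1) j) has determinant 1, hence is invertible modulo every n.
module Unimodular (t : ℕ) where

  unimodular-injective : ∀ {n i j i′ j′} →
    i + 2 * j ≡ i′ + 2 * j′ [mod n ] → t * i + (2 * t + 1) * j ≡ t * i′ + (2 * t + 1) * j′ [mod n ] →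
    i ≡ i′ [mod n ] × j ≡ j′ [mod n ]
  unimodular-injective {n} {i} {j} {i′} {j′} p q =
    mod-+-cancel (mod-trans (mod-reflexive (sym (recover-i i j)))
                            (mod-trans (mod-*ˡ (2 * t + 1) p) (mod-reflexive (recover-i i′ j′))))
                 (mod-*ˡ 2 q) ,
    mod-+-cancel (mod-trans (mod-reflexive (recover-j i j)) (mod-trans q (mod-reflexive (sym (recover-j i′ j′)))))
                 (mod-*ˡ t p)
    where
    recover-i : ∀ i j → (2 * t + 1) * (i + 2 * j) ≡ i + 2 * (t * i + (2 * t + 1) * j)
    recover-i i j = identity t i j
      where
      identity : ∀ t i j → (2 * t + 1) * (i + 2 * j) ≡ i + 2 * (t * i + (2 * t + 1) * j)
      identity = solve-∀
    recover-j : ∀ i j → j + t * (i + 2 * j) ≡ t * i + (2 * t + 1) * j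
    recover-j i j = identity t i j
      where
      identity : ∀ t i j → j + t * (i + 2 * j) ≡ t * i + (2 * t + 1) * j
      identity = solve-∀

  -- m′ ≡ −1 (mod m′+1) plays the role of the inverse matrix entries.
  unimodular-solvable : ∀ m′ x₁ x₂ → ∃₂ λ i j →
    i ≤ m′ × j ≤ m′ × i + 2 * j ≡ x₁ [mod suc m′ ] × t * i + (2 * t + 1) * j ≡ x₂ [mod suc m′ ]
  unimodular-solvable m′ x₁ x₂ =
    i , j , s≤s⁻¹ (m%n<n (x₁ + 2 * m′ * j) (suc m′)) , s≤s⁻¹ (m%n<n (x₂ + t * x₁ * m′) (suc m′)) , first , second
    where
    open ModReasoning (suc m′)
    j = (x₂ + t * x₁ * m′) % suc m′
    i = (x₁ + 2 * m′ * j) % suc m′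
    first : i + 2 * j ≡ x₁ [mod suc m′ ]
    first = begin
      i + 2 * j                  ≈⟨ mod-+ (mod-% (x₁ + 2 * m′ * j)) mod-refl ⟩
      x₁ + 2 * m′ * j + 2 * j    ≡⟨ regroup x₁ m′ j ⟩
      x₁ + 2 * j * suc m′        ≈⟨ mod-+-multiple x₁ (2 * j) ⟩
      x₁                         ∎
      where
      regroup : ∀ x₁ m′ j → x₁ + 2 * m′ * j + 2 * j ≡ x₁ + 2 * j * suc m′
      regroup = solve-∀
    second : t * i + (2 * t + 1) * j ≡ x₂ [mod suc m′ ]
    second = begin
      t * i + (2 * t + 1) * j                  ≈⟨ mod-+ (mod-*ˡ t (mod-% (x₁ + 2 * m′ * j))) mod-refl ⟩
      t * (x₁ + 2 * m′ * j) + (2 * t + 1) * j  ≡⟨ regroup t x₁ m′ j ⟩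
      t * x₁ + j + 2 * t * j * suc m′          ≈⟨ mod-+-multiple (t * x₁ + j) (2 * t * j) ⟩
      t * x₁ + j                               ≈⟨ mod-+ mod-refl (mod-% (x₂ + t * x₁ * m′)) ⟩
      t * x₁ + (x₂ + t * x₁ * m′)              ≡⟨ regroup′ t x₁ x₂ m′ ⟩
      x₂ + t * x₁ * suc m′                     ≈⟨ mod-+-multiple x₂ (t * x₁) ⟩
      x₂                                       ∎
      where
      regroup : ∀ t x₁ m′ j → t * (x₁ + 2 * m′ * j) + (2 * t + 1) * j ≡ t * x₁ + j + 2 * t * j * suc m′
      regroup = solve-∀
      regroup′ : ∀ t x₁ x₂ m′ → t * x₁ + (x₂ + t * x₁ * m′) ≡ x₂ + t * x₁ * suc m′
      regroup′ = solve-∀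

module Lifted (s c m′ : ℕ) where
  open Cyclic s c
  open Unimodular t

  m Dₘ i₀ j₀ : ℕ
  m = suc m′
  Dₘ = m * D + 2 * m′
  i₀ = m * (2 * t) + m′
  j₀ = m * (s + c) + m′

  lifted-bound : ∀ i′ j′ i″ j″ → i′ + j′ ≤ D → i″ ≤ m′ → j″ ≤ m′ → m * i′ + i″ + (m * j′ + j″) ≤ Dₘ
  lifted-bound i′ j′ i″ j″ i′+j′≤D i″≤m′ j″≤m′ =
    subst₂ _≤_ (sym (regroup m i′ i″ j′ j″)) (cong (λ x → m * D + (m′ + x)) (sym (+-identityʳ m′)))
      (+-mono-≤ (*-monoʳ-≤ m i′+j′≤D) (+-mono-≤ i″≤m′ j″≤m′))
    where
    regroup : ∀ m i′ i″ j′ j″ → m * i′ + i″ + (m * j′ + j″) ≡ m * (i′ + j′) + (i″ + j″)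
    regroup = solve-∀

  lifted-coordinate₁ : ∀ i′ j′ {i″ j″ x₁} → i″ + 2 * j″ ≡ x₁ [mod m ] →
    m * i′ + i″ + 2 * (m * j′ + j″) ≡ x₁ [mod m ]
  lifted-coordinate₁ i′ j′ {i″} {j″} {x₁} p = begin
    m * i′ + i″ + 2 * (m * j′ + j″)   ≡⟨ regroup m i′ i″ j′ j″ ⟩
    i″ + 2 * j″ + (i′ + 2 * j′) * m   ≈⟨ mod-+-multiple (i″ + 2 * j″) (i′ + 2 * j′) ⟩
    i″ + 2 * j″                       ≈⟨ p ⟩
    x₁                                ∎
    where
    open ModReasoning m
    regroup : ∀ m i′ i″ j′ j″ → m * i′ + i″ + 2 * (m * j′ + j″) ≡ i″ + 2 * j″ + (i′ + 2 * j′) * m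
    regroup = solve-∀

  lifted-coordinate₂ : ∀ i′ j′ i″ j″ {z x₂} →
    t * i′ + B * j′ ≡ z [mod N ] → t * i″ + B * j″ + m * z ≡ x₂ [mod m * N ] →
    t * (m * i′ + i″) + B * (m * j′ + j″) ≡ x₂ [mod m * N ]
  lifted-coordinate₂ i′ j′ i″ j″ {z} {x₂} r q = begin
    t * (m * i′ + i″) + B * (m * j′ + j″)     ≡⟨ regroup t B m i′ i″ j′ j″ ⟩
    m * (t * i′ + B * j′) + (t * i″ + B * j″) ≈⟨ mod-+ (mod-scale m r) mod-refl ⟩
    m * z + (t * i″ + B * j″)                 ≡⟨ +-comm (m * z) _ ⟩
    t * i″ + B * j″ + m * z                   ≈⟨ q ⟩
    x₂                                        ∎
    where
    open ModReasoning (m * N)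
    regroup : ∀ t B m i′ i″ j′ j″ →
      t * (m * i′ + i″) + B * (m * j′ + j″) ≡ m * (t * i′ + B * j′) + (t * i″ + B * j″)
    regroup = solve-∀

  -- Digits: (i″ , j″) fixes the Z_m coordinate, (i′ , j′) a covering of the cyclic quotient.
  cover-lifted : ∀ x₁ x₂ → ∃₂ λ i j → i + j ≤ Dₘ × i + 2 * j ≡ x₁ [mod m ] × t * i + B * j ≡ x₂ [mod m * N ]
  cover-lifted x₁ x₂ =
    let i″ , j″ , i″≤m′ , j″≤m′ , p₁ , p₂ = unimodular-solvable m′ x₁ x₂
        z , q = mod-lift {N = N} p₂
        i′ , j′ , i′+j′≤D , r = near z
    in m * i′ + i″ , m * j′ + j″ , lifted-bound i′ j′ i″ j″ i′+j′≤D i″≤m′ j″≤m′ ,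
       lifted-coordinate₁ i′ j′ p₁ , lifted-coordinate₂ i′ j′ i″ j″ r q

  far-residues : ∀ i j → i + 2 * j ≡ i₀ + 2 * j₀ [mod m ] → t * i + B * j ≡ t * i₀ + B * j₀ [mod m ] →
    i ≡ m′ + (i / m) * m × j ≡ m′ + (j / m) * m
  far-residues i j p q =
    mod-residue (mod-trans (proj₁ same) (residue (2 * t))) (n<1+n m′) ,
    mod-residue (mod-trans (proj₂ same) (residue (s + c))) (n<1+n m′)
    where
    same = unimodular-injective p q
    residue : ∀ X → m * X + m′ ≡ m′ [mod m ]
    residue X = mod-trans (mod-reflexive (trans (+-comm (m * X) m′) (cong (m′ +_) (*-comm m X)))) (mod-+-multiple m′ X)

  far-quotients : ∀ i′ j′ → t * (m′ + i′ * m) + B * (m′ + j′ * m) ≡ t * i₀ + B * j₀ [mod m * N ] → D ≤ i′ + j′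
  far-quotients i′ j′ q = farthest i′ j′ (mod-unscale m (mod-+-cancelʳ ((t + B) * m′) (begin
    m * (t * i′ + B * j′) + (t + B) * m′          ≡⟨ sym (expand t B m′ i′ j′) ⟩
    t * (m′ + i′ * m) + B * (m′ + j′ * m)          ≈⟨ q ⟩
    t * i₀ + B * j₀                                ≡⟨ expand₀ t B m′ (2 * t) (s + c) ⟩
    m * T + (t + B) * m′                           ∎)))
    where
    open ModReasoning (m * N)
    expand : ∀ t B m′ X Y →
      t * (m′ + X * suc m′) + B * (m′ + Y * suc m′) ≡ suc m′ * (t * X + B * Y) + (t + B) * m′
    expand = solve-∀
    expand₀ : ∀ t B m′ X Y →
      t * (suc m′ * X + m′) + B * (suc m′ * Y + m′) ≡ suc m′ * (t * X + B * Y) + (t + B) * m′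
    expand₀ = solve-∀

  far-lifted : ∀ i j →
    i + 2 * j ≡ i₀ + 2 * j₀ [mod m ] → t * i + B * j ≡ t * i₀ + B * j₀ [mod m * N ] → Dₘ ≤ i + j
  far-lifted i j p q = begin
    m * D + 2 * m′                    ≤⟨ +-monoˡ-≤ (2 * m′) (*-monoʳ-≤ m (far-quotients (i / m) (j / m) q′)) ⟩
    m * (i / m + j / m) + 2 * m′      ≡⟨ sym (trans (cong₂ _+_ i≡ j≡) (regroup m′ (i / m) (j / m))) ⟩
    i + j                             ∎
    where
    open ≤-Reasoning
    residues = far-residues i j p (mod-∣ (m∣m*n N) q)
    i≡ = proj₁ residues
    j≡ = proj₂ residues
    q′ = subst₂ (λ x y → t * x + B * y ≡ t * i₀ + B * j₀ [mod m * N ]) i≡ j≡ q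
    regroup : ∀ m′ i′ j′ → m′ + i′ * suc m′ + (m′ + j′ * suc m′) ≡ suc m′ * (i′ + j′) + 2 * m′
    regroup = solve-∀

tightCay-lifted : ∀ s c m′ {δ} → let open Cyclic s c in
  2 ≤ suc m′ → 3 * N + δ ≡ suc (3 * t + c) * suc (3 * t + c) → suc m′ * δ + 1 ≤ 2 * suc (3 * t + c) →
  TightCay (suc m′) (suc m′ * N) 1 t 2 B
tightCay-lifted s c m′ 2≤m square δ-small =
  tightCay-criterion m′ _ i₀ j₀ 2≤m (m∣m*n N) z<s (<-trans t<B B<mN) z<s B<mN diameter covers far
  where
  open Cyclic s c
  open Lifted s c m′
  form₁ : ∀ i j → i * 1 + j * 2 ≡ i + 2 * j
  form₁ = solve-∀
  form₂ : ∀ t B i j → i * t + j * B ≡ t * i + B * j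
  form₂ = solve-∀
  t<B : t < B
  t<B = subst (t <_) (identity t) (m<m+n t z<s)
    where
    identity : ∀ t → t + suc t ≡ 2 * t + 1
    identity = solve-∀
  B<mN : B < m * N
  B<mN = <-≤-trans (subst (B <_) (identity s c) (m<m+n B z<s)) (m≤n*m N m)
    where
    identity : ∀ s c → 2 * suc s + 1 + suc (3 * s * s + 6 * s + 1 + c * (2 * suc s + 1))
                     ≡ 3 * suc s * suc s + 2 * suc s + c * (2 * suc s + 1)
    identity = solve-∀
  diameter : ∀ c′ → IsCeilSqrt (3 * (m * (m * N))) c′ → c′ ∸ 2 ≡ Dₘ
  diameter c′ isCeil =
    trans (cong (_∸ 2) (trans (isCeilSqrt-scaled m′ {N} 2≤m square δ-small c′ isCeil) (identity s c m′)))
          (m+n∸n≡m Dₘ 2)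
    where
    identity : ∀ s c m′ → suc m′ * suc (3 * suc s + c) ≡ suc m′ * (2 * suc s + (s + c)) + 2 * m′ + 2
    identity = solve-∀
  covers : Coordinates.Generators.Covers m (m * N) 1 t 2 B Dₘ
  covers x₁ x₂ = let i , j , i+j≤Dₘ , p₁ , p₂ = cover-lifted x₁ x₂ in
    i , j , i+j≤Dₘ , mod-trans (mod-reflexive (form₁ i j)) p₁ , mod-trans (mod-reflexive (form₂ t B i j)) p₂
  far : Coordinates.Generators.Far m (m * N) 1 t 2 B Dₘ i₀ j₀
  far i j p₁ p₂ = far-lifted i j
    (mod-trans (mod-reflexive (sym (form₁ i j))) (mod-trans p₁ (mod-reflexive (form₁ i₀ j₀))))
    (mod-trans (mod-reflexive (sym (form₂ t B i j))) (mod-trans p₂ (mod-reflexive (form₂ t B i₀ j₀))))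

tightCay-range : ∀ s c {N δ X} → N ≡ Cyclic.N s c → 3 * N + δ ≡ suc (3 * suc s + c) * suc (3 * suc s + c) →
  X * δ + 1 ≤ 2 * suc (3 * suc s + c) → ∀ m → 2 ≤ m → m ≤ X → TightCay m (m * N) 1 (suc s) 2 (2 * suc s + 1)
tightCay-range s c refl square X-small (suc m′) 2≤m m≤X =
  tightCay-lifted s c m′ 2≤m square (≤-trans (+-monoˡ-≤ 1 (*-monoˡ-≤ _ m≤X)) X-small)

theorem7 : ∀ (t : ℕ) → 1 ≤ t →
    (∀ m → 2 ≤ m → m ≤ 6 * t + 1 → TightCay m (m * N₁ t) 1 t 2 (2 * t + 1)) ×
    (∀ m → 2 ≤ m → m ≤ 6 * t + 3 → TightCay m (m * N₂ t) 1 t 2 (2 * t + 1)) ×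
    (∀ m → 2 ≤ m → m ≤ 2 * t + 1 → TightCay m (m * N₃ t) 2 (2 * t + 1) 1 t)
theorem7 zero ()
theorem7 (suc s) _ =
  tightCay-range s 0 (N≡₁ s) (square₁ s) (≤-reflexive (bound₁ s)) ,
  tightCay-range s 1 (N≡₂ s) (square₂ s) (≤-reflexive (bound₂ s)) ,
  λ m 2≤m m≤2t+1 → swap-tightCay m _
    (tightCay-range s 2 (N≡₃ s) (square₃ s) (≤-trans (m≤m+n _ 2) (≤-reflexive (bound₃ s))) m 2≤m m≤2t+1)
  where
  N≡₁ : ∀ s → 3 * suc s * suc s + 2 * suc s ≡ 3 * suc s * suc s + 2 * suc s + 0 * (2 * suc s + 1)
  N≡₁ = solve-∀
  N≡₂ : ∀ s → 3 * suc s * suc s + 4 * suc s + 1 ≡ 3 * suc s * suc s + 2 * suc s + 1 * (2 * suc s + 1)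
  N≡₂ = solve-∀
  N≡₃ : ∀ s → 3 * suc s * suc s + 6 * suc s + 2 ≡ 3 * suc s * suc s + 2 * suc s + 2 * (2 * suc s + 1)
  N≡₃ = solve-∀
  square₁ : ∀ s → 3 * (3 * suc s * suc s + 2 * suc s) + 1 ≡ suc (3 * suc s + 0) * suc (3 * suc s + 0)
  square₁ = solve-∀
  square₂ : ∀ s → 3 * (3 * suc s * suc s + 4 * suc s + 1) + 1 ≡ suc (3 * suc s + 1) * suc (3 * suc s + 1)
  square₂ = solve-∀
  square₃ : ∀ s → 3 * (3 * suc s * suc s + 6 * suc s + 2) + 3 ≡ suc (3 * suc s + 2) * suc (3 * suc s + 2)
  square₃ = solve-∀
  bound₁ : ∀ s → (6 * suc s + 1) * 1 + 1 ≡ 2 * suc (3 * suc s + 0)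
  bound₁ = solve-∀
  bound₂ : ∀ s → (6 * suc s + 3) * 1 + 1 ≡ 2 * suc (3 * suc s + 1)
  bound₂ = solve-∀
  bound₃ : ∀ s → (2 * suc s + 1) * 3 + 1 + 2 ≡ 2 * suc (3 * suc s + 2)
  bound₃ = solve-∀
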